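{- Let $G$ be a cactus graph with cycles $C_1,\ldots,C_c$ and let $S\subseteq V(G)$. If $S$ is a vertex (resp. edge) metric generator in $G$, then for every $i\in\{1,\ldots,c\}$ the regional set $S_i$ is a vertex (resp. edge) metric generator in the unicyclic region $G_i$.
   Context: All graphs are finite, simple and connected; $d(u,v)$ is the distance, and for a vertex $u$ and edge $vw$, $d(u,vw)=\min\{d(u,v),d(u,w)\}$ (distances in a subgraph $H$ are computed in $H$). A vertex $s$ distinguishes vertices (resp. edges) $x,x'$ if $d(s,x)\ne d(s,x')$. $S\subseteq V(H)$ is a vertex (resp. edge) metric generator of a graph $H$ if every pair of distinct vertices (resp. edges) of $H$ is distinguished by some vertex of $S$. A cactus graph is a connected graph whose cycles are pairwise edge-disjoint. A vertex $v$ gravitates to the cycle $C_i$ if there is a path from $v$ to a vertex of $C_i$ which shares no edge and no internal vertex with any cycle of $G$. The unicyclic region $G_i$ of $C_i$ is the subgraph of $G$ induced by all vertices gravitating to $C_i$. A vertex $v$ of $G_i$ is a boundary vertex of $G_i$ if $v\in V(C_j)$ for some $j\neq i$. The regional set $S_i$ is $(S\cap V(G_i))\cup\{\text{all boundary vertices of } G_i\}$. -}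

module Defs where

open import Data.Nat using (ℕ; zero; suc; _+_; _<_; _≤_; _⊓_)
open import Data.Fin using (Fin; zero; suc; toℕ; inject₁; fromℕ)
open import Data.Fin.Subset using (Subset; _∈_)
open import Data.Bool using (Bool; T)
open import Data.Product using (Σ; ∃; ∃-syntax; _×_; _,_)
open import Data.Sum using (_⊎_)
open import Data.Unit using (⊤)
open import Relation.Nullary using (¬_)
open import Relation.Binary.PropositionalEquality using (_≡_; _≢_)
open import Function.Definitions using (Injective)

record Graph (n : ℕ) : Set where
  field
    adj    : Fin n → Fin n → Bool
    sym    : ∀ u v → T (adj u v) → T (adj v u)
    irrefl : ∀ u → ¬ T (adj u u)

module _ {n : ℕ} (G : Graph n) where

  Adj : Fin n → Fin n → Set
  Adj u v = T (Graph.adj G u v)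

  -- Walks of length k from u to v all of whose vertices satisfy P
  -- (i.e. walks in the subgraph induced by P).
  data Walk (P : Fin n → Set) : Fin n → Fin n → ℕ → Set where
    here : ∀ {u} → P u → Walk P u u 0
    step : ∀ {u w v k} → P u → Adj u w → Walk P w v k → Walk P u v (suc k)

  Dist : (Fin n → Set) → Fin n → Fin n → ℕ → Set
  Dist P u v k = Walk P u v k × (∀ j → Walk P u v j → k ≤ j)

  DistE : (Fin n → Set) → Fin n → Fin n → Fin n → ℕ → Set
  DistE P u v w k = ∃[ a ] ∃[ b ] (Dist P u v a × Dist P u w b × k ≡ a ⊓ b)

  Connected : Set
  Connected = ∀ u v → ∃[ k ] Walk (λ _ → ⊤) u v k

  DistinguishesV : (Fin n → Set) → Fin n → Fin n → Fin n → Set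
  DistinguishesV P s x y = ∃[ a ] ∃[ b ] (Dist P s x a × Dist P s y b × a ≢ b)

  DistinguishesE : (Fin n → Set) → Fin n → Fin n → Fin n → Fin n → Fin n → Set
  DistinguishesE P s x x' y y' =
    ∃[ a ] ∃[ b ] (DistE P s x x' a × DistE P s y y' b × a ≢ b)

  EdgeOf : (Fin n → Set) → Fin n → Fin n → Set
  EdgeOf P u v = P u × P v × Adj u v × toℕ u < toℕ v

  VertexMetricGenerator : (Fin n → Set) → (Fin n → Set) → Set
  VertexMetricGenerator P Q =
    (∀ s → Q s → P s) ×
    (∀ x y → P x → P y → x ≢ y → ∃[ s ] (Q s × DistinguishesV P s x y))

  EdgeMetricGenerator : (Fin n → Set) → (Fin n → Set) → Set
  EdgeMetricGenerator P Q =
    (∀ s → Q s → P s) ×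
    (∀ x x' y y' → EdgeOf P x x' → EdgeOf P y y' → ¬ (x ≡ y × x' ≡ y') →
       ∃[ s ] (Q s × DistinguishesE P s x x' y y'))

  record Cycle : Set where
    field
      k     : ℕ
      vs    : Fin (suc (suc (suc k))) → Fin n
      inj   : Injective _≡_ _≡_ vs
      steps : ∀ (i : Fin (suc (suc k))) → Adj (vs (inject₁ i)) (vs (suc i))
      close : Adj (vs (fromℕ (suc (suc k)))) (vs zero)

  OnCycle : Cycle → Fin n → Set
  OnCycle C v = ∃[ i ] (v ≡ Cycle.vs C i)

  CycleStep : Cycle → Fin n → Fin n → Set
  CycleStep C u v =
    (∃[ i ] (u ≡ Cycle.vs C (inject₁ i) × v ≡ Cycle.vs C (suc i)))
    ⊎ (u ≡ Cycle.vs C (fromℕ (suc (suc (Cycle.k C)))) × v ≡ Cycle.vs C zero)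

  OnCycleEdge : Cycle → Fin n → Fin n → Set
  OnCycleEdge C u v = CycleStep C u v ⊎ CycleStep C v u

  -- two cycles are the same subgraph iff they have the same edge set
  SameCycle : Cycle → Cycle → Set
  SameCycle C D = ∀ u v → (OnCycleEdge C u v → OnCycleEdge D u v)
                        × (OnCycleEdge D u v → OnCycleEdge C u v)

  Cactus : Set
  Cactus = ∀ (C D : Cycle) u v → OnCycleEdge C u v → OnCycleEdge D u v → SameCycle C D

  OnSomeCycle : Fin n → Set
  OnSomeCycle v = ∃[ D ] OnCycle D v

  record GravPath (C : Cycle) (v : Fin n) : Set where
    field
      m        : ℕ
      p        : Fin (suc m) → Fin n
      inj      : Injective _≡_ _≡_ p
      start    : p zero ≡ v
      end      : OnCycle C (p (fromℕ m))
      steps    : ∀ (i : Fin m) → Adj (p (inject₁ i)) (p (suc i))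
      noEdge   : ∀ (i : Fin m) (D : Cycle) → ¬ OnCycleEdge D (p (inject₁ i)) (p (suc i))
      noVertex : ∀ (i : Fin (suc m)) → i ≢ zero → i ≢ fromℕ m →
                 ∀ (D : Cycle) → ¬ OnCycle D (p i)

  Gravitates : Cycle → Fin n → Set
  Gravitates C v = GravPath C v

  -- vertex set of the unicyclic region G_C (G_C is the induced subgraph)
  InRegion : Cycle → Fin n → Set
  InRegion C v = Gravitates C v

  BoundaryVertex : Cycle → Fin n → Set
  BoundaryVertex C v = InRegion C v × ∃[ D ] (OnCycle D v × ¬ SameCycle C D)

  RegionalSet : Subset n → Cycle → Fin n → Set
  RegionalSet S C v = (v ∈ S × InRegion C v) ⊎ BoundaryVertex C v

-- Two distinct vertices of the unicyclic region G_C cannot be joined by a detour, i.e. a path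
-- with at least one inner vertex and all inner vertices outside G_C. Closing a detour up by a
-- path inside G_C that uses only edges of C and edges lying on no cycle gives a cycle through
-- one of these edges. That edge cannot lie on no cycle, and a cycle sharing an edge with C is C
-- itself (G is a cactus), which would put the detour on C, hence inside G_C. So shortest paths
-- between vertices of G_C stay in G_C, and a vertex s outside G_C enters G_C through a single
-- boundary vertex b, so that d(s,x) = d(s,b) + d(b,x) for every vertex x of G_C. A vertex of S
-- distinguishing two vertices or edges of G_C therefore either lies in G_C or can be replaced
-- by b, which lies in S_C. As G is finite, all predicates involved are decidable, which
-- licenses the case distinctions.
module Submission where

open import Defs
open import Data.Nat using (ℕ; zero; suc; _+_; _≤_; _<_; _⊓_; s≤s)
open import Data.Nat.Properties
  using ( anyUpTo?; ≤-trans; ≤-refl; m≤n+m; n≤1+n; m≤n⇒m≤1+n; ≤-pred; ≤-antisym; ≮⇒≥; ≤⇒≯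
        ; +-mono-≤; +-suc; +-distribˡ-⊓)
open import Data.Nat.Induction using (<-rec)
open import Data.Fin using (Fin; zero; suc; inject₁; fromℕ; _≟_)
open import Data.Fin.Properties using (any?; all?; injective⇒≤; suc-injective)
open import Data.Fin.Subset using (Subset; _∈_)
open import Data.Vec.Functional using (_∷_; head; tail)
open import Data.Product as Product
  using (Σ; ∃; ∃₂; ∃-syntax; _×_; _,_; proj₁; proj₂; curry; uncurry)
open import Data.Sum as Sum using (_⊎_; inj₁; inj₂; [_,_]′)
open import Data.Empty using (⊥; ⊥-elim)
open import Data.Unit using (⊤; tt)
open import Function using (_∘_)
open import Function.Definitions using (Injective)
open import Relation.Nullary using (¬_; Dec; yes; no)
open import Relation.Nullary.Decidable using (map′; _×-dec_; _⊎-dec_; ¬?; _→-dec_; T?)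
open import Relation.Binary.Definitions using (_Respects_)
open import Relation.Binary.PropositionalEquality
  using (_≡_; _≢_; _≗_; refl; sym; trans; cong; cong₂; subst; subst₂; module ≡-Reasoning)

anyFunction? : ∀ {m N} {Q : (Fin m → Fin N) → Set} → Q Respects _≗_ →
               (∀ f → Dec (Q f)) → Dec (∃ Q)
anyFunction? {zero} resp Q? with Q? (λ ())
... | yes q = yes (_ , q)
... | no ¬q = no λ (f , q) → ¬q (resp (λ ()) q)
anyFunction? {suc m} {Q = Q} resp Q? =
  map′ (λ (x , g , q) → x ∷ g , q)
       (λ (f , q) → head f , tail f , resp (λ { zero → refl ; (suc i) → refl }) q)
       (any? λ x → anyFunction? {Q = Q ∘ (x ∷_)}
                     (λ f≗g → resp λ { zero → refl ; (suc i) → f≗g i })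
                     (Q? ∘ (x ∷_)))

injective? : ∀ {m N} (f : Fin m → Fin N) → Dec (Injective _≡_ _≡_ f)
injective? f = map′ (λ h {i} {j} → h i j) (λ h i j → h)
                    (all? λ i → all? λ j → (f i ≟ f j) →-dec (i ≟ j))

injective-resp-≗ : ∀ {m N} → Injective {A = Fin m} {B = Fin N} _≡_ _≡_ Respects _≗_
injective-resp-≗ f≗g inj {i} {j} gi≡gj = inj (trans (f≗g i) (trans gi≡gj (sym (f≗g j))))

opaque
  -- Opaque: unfolding this exhaustive search, e.g. when a `with` scrutinises a decision built
  -- on it, makes type checking prohibitively slow. Injectivity bounds c + ℓ by N, so only
  -- finitely many lengths ℓ need to be tried.
  anyInjectiveSequence? : ∀ {N} c (Φ : (ℓ : ℕ) → (Fin (c + ℓ) → Fin N) → Set) →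
                          (∀ ℓ → Φ ℓ Respects _≗_) → (∀ ℓ f → Dec (Φ ℓ f)) →
                          Dec (∃₂ λ ℓ f → Injective _≡_ _≡_ f × Φ ℓ f)
  anyInjectiveSequence? {N} c Φ resp Φ? =
    map′ (λ (ℓ , _ , f , φ) → ℓ , f , φ)
         (λ (ℓ , f , inj , φ) → ℓ , s≤s (≤-trans (m≤n+m ℓ c) (injective⇒≤ inj)) ,
                                f , (λ {i} {j} → inj {i} {j}) , φ)
         (anyUpTo? (λ ℓ → anyFunction? (λ f≗g → Product.map (injective-resp-≗ f≗g) (resp ℓ f≗g))
                                       (λ f → injective? f ×-dec Φ? ℓ f))
                   (suc N))

module _ {n : ℕ} (G : Graph n) where

  adj? : ∀ u v → Dec (Adj G u v)
  adj? u v = T? (Graph.adj G u v)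

  -- `CycleStep` and the laws of `Cycle` for a bare vertex sequence, so that cycles can be searched for.
  CyclicStep : ∀ k → (Fin (3 + k) → Fin n) → Fin n → Fin n → Set
  CyclicStep k vs u v = (∃[ i ] (u ≡ vs (inject₁ i) × v ≡ vs (suc i)))
                      ⊎ (u ≡ vs (fromℕ (2 + k)) × v ≡ vs zero)

  cyclicStep? : ∀ k vs u v → Dec (CyclicStep k vs u v)
  cyclicStep? k vs u v = any? (λ i → (u ≟ _) ×-dec (v ≟ _)) ⊎-dec ((u ≟ _) ×-dec (v ≟ _))

  cyclicStep-resp-≗ : ∀ k u v → (λ vs → CyclicStep k vs u v) Respects _≗_
  cyclicStep-resp-≗ k u v f≗g (inj₁ (i , eu , ev)) = inj₁ (i , trans eu (f≗g _) , trans ev (f≗g _))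
  cyclicStep-resp-≗ k u v f≗g (inj₂ (eu , ev))     = inj₂ (trans eu (f≗g _) , trans ev (f≗g _))

  CycleLaws : ∀ k → (Fin (3 + k) → Fin n) → Set
  CycleLaws k vs = (∀ i → Adj G (vs (inject₁ i)) (vs (suc i))) × Adj G (vs (fromℕ (2 + k))) (vs zero)

  cycleLaws-resp-≗ : ∀ k → CycleLaws k Respects _≗_
  cycleLaws-resp-≗ k f≗g (steps , close) =
    (λ i → subst₂ (Adj G) (f≗g _) (f≗g _) (steps i)) , subst₂ (Adj G) (f≗g _) (f≗g _) close

  anyCycle? : (Φ : ∀ k → (Fin (3 + k) → Fin n) → Set) → (∀ k → Φ k Respects _≗_) →
              (∀ k vs → Dec (Φ k vs)) → Dec (Σ (Cycle G) λ D → Φ (Cycle.k D) (Cycle.vs D))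
  anyCycle? Φ resp Φ? =
    map′ fromSequence toSequence
         (anyInjectiveSequence? 3 (λ k vs → CycleLaws k vs × Φ k vs)
            (λ k f≗g → Product.map (cycleLaws-resp-≗ k f≗g) (resp k f≗g))
            (λ k vs → ((all? λ i → adj? _ _) ×-dec adj? _ _) ×-dec Φ? k vs))
    where
    Sequence : Set
    Sequence = ∃₂ λ k vs → Injective _≡_ _≡_ vs × CycleLaws k vs × Φ k vs

    fromSequence : Sequence → Σ (Cycle G) λ D → Φ (Cycle.k D) (Cycle.vs D)
    fromSequence (k , vs , inj , (steps , close) , φ) =
      record { k = k ; vs = vs ; inj = inj ; steps = steps ; close = close } , φ

    toSequence : (Σ (Cycle G) λ D → Φ (Cycle.k D) (Cycle.vs D)) → Sequence
    toSequence (D , φ) =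
      Cycle.k D , Cycle.vs D , (λ {i} {j} → Cycle.inj D {i} {j}) , (Cycle.steps D , Cycle.close D) , φ

  onCycle? : ∀ D v → Dec (OnCycle G D v)
  onCycle? D v = any? λ i → v ≟ Cycle.vs D i

  onCycleEdge? : ∀ D u v → Dec (OnCycleEdge G D u v)
  onCycleEdge? D u v = cyclicStep? (Cycle.k D) (Cycle.vs D) u v ⊎-dec cyclicStep? (Cycle.k D) (Cycle.vs D) v u

  onSomeCycle? : ∀ v → Dec (OnSomeCycle G v)
  onSomeCycle? v = anyCycle? (λ k vs → ∃[ i ] (v ≡ vs i))
                             (λ k f≗g (i , e) → i , trans e (f≗g i)) (λ k vs → any? λ i → v ≟ vs i)

  onSomeCycleEdge? : ∀ u v → Dec (Σ (Cycle G) λ D → OnCycleEdge G D u v)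
  onSomeCycleEdge? u v =
    anyCycle? (λ k vs → CyclicStep k vs u v ⊎ CyclicStep k vs v u)
              (λ k f≗g → Sum.map (cyclicStep-resp-≗ k u v f≗g) (cyclicStep-resp-≗ k v u f≗g))
              (λ k vs → cyclicStep? k vs u v ⊎-dec cyclicStep? k vs v u)

  GravLaws : Cycle G → Fin n → ∀ m → (Fin (1 + m) → Fin n) → Set
  GravLaws C v m p =
    p zero ≡ v × OnCycle G C (p (fromℕ m)) ×
    (∀ i → Adj G (p (inject₁ i)) (p (suc i))) ×
    (∀ i D → ¬ OnCycleEdge G D (p (inject₁ i)) (p (suc i))) ×
    (∀ i → i ≢ zero → i ≢ fromℕ m → ∀ D → ¬ OnCycle G D (p i))

  gravLaws-resp-≗ : ∀ C v m → GravLaws C v m Respects _≗_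
  gravLaws-resp-≗ C v m f≗g (start , (i , end) , steps , noEdge , noVertex) =
    trans (sym (f≗g zero)) start , (i , trans (sym (f≗g _)) end) ,
    (λ i → subst₂ (Adj G) (f≗g _) (f≗g _) (steps i)) ,
    (λ i D e → noEdge i D (subst₂ (OnCycleEdge G D) (sym (f≗g _)) (sym (f≗g _)) e)) ,
    (λ i i≢0 i≢m D o → noVertex i i≢0 i≢m D (subst (OnCycle G D) (sym (f≗g i)) o))

  gravLaws? : ∀ C v m p → Dec (GravLaws C v m p)
  gravLaws? C v m p =
    (p zero ≟ v) ×-dec onCycle? C _ ×-dec (all? λ i → adj? _ _) ×-dec
    map′ (λ h i → curry (h i)) (λ h i → uncurry (h i)) (all? λ i → ¬? (onSomeCycleEdge? _ _)) ×-dec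
    map′ (λ h i i≢0 i≢m → curry (h i i≢0 i≢m)) (λ h i i≢0 i≢m → uncurry (h i i≢0 i≢m))
         (all? λ i → ¬? (i ≟ zero) →-dec ¬? (i ≟ fromℕ m) →-dec ¬? (onSomeCycle? (p i)))

  toGravPath : ∀ {C v m p} → Injective _≡_ _≡_ p → GravLaws C v m p → GravPath G C v
  toGravPath {m = m} {p} inj (start , end , steps , noEdge , noVertex) = record
    { m = m ; p = p ; inj = inj ; start = start ; end = end
    ; steps = steps ; noEdge = noEdge ; noVertex = noVertex }

  gravLaws : ∀ {C v} (Q : GravPath G C v) → GravLaws C v (GravPath.m Q) (GravPath.p Q)
  gravLaws Q = GravPath.start Q , GravPath.end Q , GravPath.steps Q , GravPath.noEdge Q , GravPath.noVertex Q

  inRegion? : ∀ C v → Dec (InRegion G C v)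
  inRegion? C v =
    map′ (λ (_ , _ , inj , laws) → toGravPath inj laws) toSequence
         (anyInjectiveSequence? 1 (GravLaws C v) (gravLaws-resp-≗ C v) (gravLaws? C v))
    where
    toSequence : InRegion G C v → ∃₂ λ m p → Injective _≡_ _≡_ p × GravLaws C v m p
    toSequence Q = GravPath.m Q , GravPath.p Q , (λ {i} {j} → GravPath.inj Q {i} {j}) , gravLaws Q

  ⊤ᵛ : Fin n → Set
  ⊤ᵛ _ = ⊤

  ⊤ᵉ : Fin n → Fin n → Set
  ⊤ᵉ _ _ = ⊤

  data RWalk (P : Fin n → Set) (B : Fin n → Fin n → Set) : Fin n → Fin n → ℕ → Set where
    here : ∀ {u} → P u → RWalk P B u u 0
    step : ∀ {u w v k} → P u → Adj G u w → B u w → RWalk P B w v k → RWalk P B u v (suc k)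

  toWalk : ∀ {P B u v k} → RWalk P B u v k → Walk G P u v k
  toWalk (here p)       = here p
  toWalk (step p a _ W) = step p a (toWalk W)

  fromWalk : ∀ {P u v k} → Walk G P u v k → RWalk P ⊤ᵉ u v k
  fromWalk (here p)     = here p
  fromWalk (step p a W) = step p a tt (fromWalk W)

  module _ {P : Fin n → Set} {B : Fin n → Fin n → Set} where

    data _∈ᵂ_ (x : Fin n) : ∀ {u v k} → RWalk P B u v k → Set where
      first : ∀ {v k} {W : RWalk P B x v k} → x ∈ᵂ W
      later : ∀ {u w v k p a b} {W : RWalk P B w v k} → x ∈ᵂ W → x ∈ᵂ step {u = u} p a b W

    IsPath : ∀ {u v k} → RWalk P B u v k → Set
    IsPath (here _)           = ⊤
    IsPath (step {u} _ _ _ W) = ¬ u ∈ᵂ W × IsPath W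

    start∈P : ∀ {u v k} → RWalk P B u v k → P u
    start∈P (here p)       = p
    start∈P (step p _ _ _) = p

    ∈ᵂ⇒P : ∀ {u v k x} (W : RWalk P B u v k) → x ∈ᵂ W → P x
    ∈ᵂ⇒P W              first       = start∈P W
    ∈ᵂ⇒P (step _ _ _ W) (later x∈W) = ∈ᵂ⇒P W x∈W

    end∈P : ∀ {u v k} → RWalk P B u v k → P v
    end∈P (here p)       = p
    end∈P (step _ _ _ W) = end∈P W

    _++_ : ∀ {u v w k j} → RWalk P B u v k → RWalk P B v w j → RWalk P B u w (k + j)
    here _       ++ W′ = W′
    step p a b W ++ W′ = step p a b (W ++ W′)

    snoc : ∀ {u v w k} → RWalk P B u v k → Adj G v w → B v w → P w → RWalk P B u w (suc k)
    snoc (here p)         a b q = step p a b (here q)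
    snoc (step p a′ b′ W) a b q = step p a′ b′ (snoc W a b q)

    reverse : (∀ {u v} → B u v → B v u) → ∀ {u v k} → RWalk P B u v k → RWalk P B v u k
    reverse B-sym (here p)       = here p
    reverse B-sym (step p a b W) = snoc (reverse B-sym W) (Graph.sym G _ _ a) (B-sym b) p

    bridge : ∀ {u v v′ w k j} → RWalk P B u v k → Adj G v v′ → B v v′ → RWalk P B v′ w j →
             RWalk P B u w (suc (k + j))
    bridge (here p)         a b W′ = step p a b W′
    bridge (step p a′ b′ W) a b W′ = step p a′ b′ (bridge W a b W′)

    ∈-bridge : ∀ {u v v′ w k j x} (W : RWalk P B u v k) (a : Adj G v v′) (b : B v v′)
               (W′ : RWalk P B v′ w j) → x ∈ᵂ bridge W a b W′ → x ∈ᵂ W ⊎ x ∈ᵂ W′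
    ∈-bridge (here _)       a b W′ first      = inj₁ first
    ∈-bridge (here _)       a b W′ (later x∈) = inj₂ x∈
    ∈-bridge (step _ _ _ W) a b W′ first      = inj₁ first
    ∈-bridge (step _ _ _ W) a b W′ (later x∈) = Sum.map₁ later (∈-bridge W a b W′ x∈)

    bridge-isPath : ∀ {u v v′ w k j} (W : RWalk P B u v k) (a : Adj G v v′) (b : B v v′)
                    (W′ : RWalk P B v′ w j) → IsPath W → IsPath W′ →
                    (∀ {x} → x ∈ᵂ W → ¬ x ∈ᵂ W′) → IsPath (bridge W a b W′)
    bridge-isPath (here _)       a b W′ _            path′ disjoint =
      disjoint first , path′
    bridge-isPath (step _ _ _ W) a b W′ (u∉W , path) path′ disjoint =
      [ u∉W , disjoint first ]′ ∘ ∈-bridge W a b W′ ,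
      bridge-isPath W a b W′ path path′ (disjoint ∘ later)

    suffix : ∀ {u v k x} (W : RWalk P B u v k) → x ∈ᵂ W → ∃[ j ] (j ≤ k × RWalk P B x v j)
    suffix W              first       = _ , ≤-refl , W
    suffix (step p a b W) (later x∈W) = Product.map₂ (Product.map₁ m≤n⇒m≤1+n) (suffix W x∈W)

    Shortest : ∀ {u v k} → RWalk P B u v k → Set
    Shortest {u} {v} {k} _ = ∀ j → RWalk P B u v j → k ≤ j

    shortest-tail : ∀ {u w v k} (p : P u) (a : Adj G u w) (b : B u w) (W : RWalk P B w v k) →
                    Shortest (step p a b W) → Shortest W
    shortest-tail p a b W shortest j W′ = ≤-pred (shortest (suc j) (step p a b W′))

    shortest⇒isPath : ∀ {u v k} (W : RWalk P B u v k) → Shortest W → IsPath W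
    shortest⇒isPath (here _)       _        = tt
    shortest⇒isPath (step p a b W) shortest =
      (λ u∈W → let j , j≤k , W′ = suffix W u∈W in ≤⇒≯ (shortest j W′) (s≤s j≤k)) ,
      shortest⇒isPath W (shortest-tail p a b W shortest)

    vertexAt : ∀ {u v k} → RWalk P B u v k → Fin (suc k) → Fin n
    vertexAt (here {u} _)       _       = u
    vertexAt (step {u} _ _ _ W) zero    = u
    vertexAt (step _ _ _ W)     (suc i) = vertexAt W i

    vertexAt-start : ∀ {u v k} (W : RWalk P B u v k) → vertexAt W zero ≡ u
    vertexAt-start (here _)       = refl
    vertexAt-start (step _ _ _ _) = refl

    vertexAt-end : ∀ {u v k} (W : RWalk P B u v k) → vertexAt W (fromℕ k) ≡ v
    vertexAt-end (here _)       = refl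
    vertexAt-end (step _ _ _ W) = vertexAt-end W

    vertexAt-adjacent : ∀ {u v k} (W : RWalk P B u v k) (i : Fin k) →
                        Adj G (vertexAt W (inject₁ i)) (vertexAt W (suc i))
    vertexAt-adjacent (step _ a _ W) zero    = subst (Adj G _) (sym (vertexAt-start W)) a
    vertexAt-adjacent (step _ _ _ W) (suc i) = vertexAt-adjacent W i

    vertexAt-∈ᵂ : ∀ {u v k} (W : RWalk P B u v k) i → vertexAt W i ∈ᵂ W
    vertexAt-∈ᵂ (here _)       zero    = first
    vertexAt-∈ᵂ (step _ _ _ W) zero    = first
    vertexAt-∈ᵂ (step _ _ _ W) (suc i) = later (vertexAt-∈ᵂ W i)

    vertexAt-injective : ∀ {u v k} (W : RWalk P B u v k) → IsPath W → Injective _≡_ _≡_ (vertexAt W)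
    vertexAt-injective (here _)       _           {zero}  {zero}  _  = refl
    vertexAt-injective (step _ _ _ W) _           {zero}  {zero}  _  = refl
    vertexAt-injective (step _ _ _ W) (u∉W , _)   {zero}  {suc j} eq =
      ⊥-elim (u∉W (subst (_∈ᵂ W) (sym eq) (vertexAt-∈ᵂ W j)))
    vertexAt-injective (step _ _ _ W) (u∉W , _)   {suc i} {zero}  eq =
      ⊥-elim (u∉W (subst (_∈ᵂ W) eq (vertexAt-∈ᵂ W i)))
    vertexAt-injective (step _ _ _ W) (_ , path)  {suc i} {suc j} eq =
      cong suc (vertexAt-injective W path eq)

    cycleOfPath : ∀ {u w v k} (p : P u) (a : Adj G u w) (b : B u w) (W : RWalk P B w v (suc k)) →
                  IsPath (step p a b W) → Adj G v u →
                  Σ (Cycle G) λ E → OnCycleEdge G E u w × OnCycleEdge G E v u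
    cycleOfPath {u} {w} {v} {k} p a b W path closing =
      record { k = k ; vs = vertexAt W′ ; inj = vertexAt-injective W′ path
             ; steps = vertexAt-adjacent W′
             ; close = subst₂ (Adj G) (sym (vertexAt-end W)) refl closing } ,
      inj₁ (inj₁ (zero , refl , sym (vertexAt-start W))) ,
      inj₁ (inj₂ (sym (vertexAt-end W) , refl))
      where
      W′ : RWalk P B u v (suc (suc k))
      W′ = step p a b W

    walkAlong : ∀ L (f : Fin (suc L) → Fin n) → (∀ i → P (f i)) →
                (∀ i → Adj G (f (inject₁ i)) (f (suc i))) → (∀ i → B (f (inject₁ i)) (f (suc i))) →
                ∀ j → ∃[ k ] RWalk P B (f j) (f (fromℕ L)) k
    walkAlong zero    f fP fA fB zero    = 0 , here (fP zero)
    walkAlong (suc L) f fP fA fB zero    =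
      Product.map suc (step (fP zero) (fA zero) (fB zero))
        (walkAlong L (f ∘ suc) (fP ∘ suc) (fA ∘ suc) (fB ∘ suc) zero)
    walkAlong (suc L) f fP fA fB (suc j) = walkAlong L (f ∘ suc) (fP ∘ suc) (fA ∘ suc) (fB ∘ suc) j

  module _ {P : Fin n → Set} {B : Fin n → Fin n → Set} where

    forget : ∀ {u v k} → RWalk P B u v k → RWalk ⊤ᵛ ⊤ᵉ u v k
    forget (here _)       = here tt
    forget (step _ a _ W) = step tt a tt (forget W)

    ∈-forget : ∀ {u v k x} (W : RWalk P B u v k) → x ∈ᵂ forget W → x ∈ᵂ W
    ∈-forget (here _)       first       = first
    ∈-forget (step _ _ _ W) first       = first
    ∈-forget (step _ _ _ W) (later x∈W) = later (∈-forget W x∈W)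

    forget-isPath : ∀ {u v k} (W : RWalk P B u v k) → IsPath W → IsPath (forget W)
    forget-isPath (here _)       _            = tt
    forget-isPath (step _ _ _ W) (u∉W , path) = u∉W ∘ ∈-forget W , forget-isPath W path

  module _ {P : Fin n → Set} {B : Fin n → Fin n → Set}
           (P? : ∀ x → Dec (P x)) (B? : ∀ u v → Dec (B u v)) where

    rwalk? : ∀ u v k → Dec (RWalk P B u v k)
    rwalk? u v zero    = map′ (λ (u≡v , p) → subst (λ v → RWalk P B u v 0) u≡v (here p))
                              (λ { (here p) → refl , p }) ((u ≟ v) ×-dec P? u)
    rwalk? u v (suc k) = map′ (λ (w , p , a , b , W) → step p a b W)
                              (λ { (step p a b W) → _ , p , a , b , W })
                              (any? λ w → P? u ×-dec adj? u w ×-dec B? u w ×-dec rwalk? w v k)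

    shortest : ∀ {u v k} → RWalk P B u v k → ∃[ j ] Σ (RWalk P B u v j) Shortest
    shortest {u} {v} {k} = <-rec (λ k → RWalk P B u v k → ∃[ j ] Σ (RWalk P B u v j) Shortest) go k
      where
      go : ∀ k → (∀ {j} → j < k → RWalk P B u v j → ∃[ i ] Σ (RWalk P B u v i) Shortest) →
           RWalk P B u v k → ∃[ j ] Σ (RWalk P B u v j) Shortest
      go k shorten W with anyUpTo? (rwalk? u v) k
      ... | yes (j , j<k , W′) = shorten j<k W′
      ... | no  none           = k , W , λ j W′ → ≮⇒≥ λ j<k → none (j , j<k , W′)

  distance : Connected G → ∀ u v → ∃[ d ] Dist G ⊤ᵛ u v d
  distance connected u v =
    let d , W , minimal = shortest (λ _ → yes tt) (λ _ _ → yes tt) (fromWalk (proj₂ (connected u v)))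
    in d , toWalk W , λ j W′ → minimal j (fromWalk W′)

  adjacent⇒≢ : ∀ {u v} → Adj G u v → u ≢ v
  adjacent⇒≢ {u} a refl = Graph.irrefl G u a

  onCycleEdge-sym : ∀ D {u v} → OnCycleEdge G D u v → OnCycleEdge G D v u
  onCycleEdge-sym D = Sum.swap

  cycleStep-ends : ∀ D {u v} → CycleStep G D u v → OnCycle G D u × OnCycle G D v
  cycleStep-ends D (inj₁ (i , u≡ , v≡)) = (inject₁ i , u≡) , (suc i , v≡)
  cycleStep-ends D (inj₂ (u≡ , v≡))     = (_ , u≡) , (zero , v≡)

  onCycleEdge-ends : ∀ D {u v} → OnCycleEdge G D u v → OnCycle G D u × OnCycle G D v
  onCycleEdge-ends D (inj₁ uv) = cycleStep-ends D uv
  onCycleEdge-ends D (inj₂ vu) = Product.swap (cycleStep-ends D vu)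

  onCycle⇒onCycleEdge : ∀ D {v} → OnCycle G D v → ∃[ u ] OnCycleEdge G D u v
  onCycle⇒onCycleEdge D (zero  , v≡) = _ , inj₁ (inj₂ (refl , v≡))
  onCycle⇒onCycleEdge D (suc i , v≡) = _ , inj₁ (inj₁ (i , refl , v≡))

  sameCycle-onCycle : ∀ {C D v} → SameCycle G C D → OnCycle G D v → OnCycle G C v
  sameCycle-onCycle {C} {D} C≈D v∈D =
    let u , uv∈D = onCycle⇒onCycleEdge D v∈D in proj₂ (onCycleEdge-ends C (proj₂ (C≈D u _) uv∈D))

  module Region (cactus : Cactus G) (C : Cycle G) where

    Inside : Fin n → Set
    Inside = InRegion G C

    Outside : Fin n → Set
    Outside v = ¬ Inside v

    inside? : ∀ v → Dec (Inside v)
    inside? = inRegion? C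

    outside? : ∀ v → Dec (Outside v)
    outside? v = ¬? (inside? v)

    onCycle⇒inside : ∀ {v} → OnCycle G C v → Inside v
    onCycle⇒inside {v} v∈C = toGravPath {m = 0} {p = λ _ → v} (λ { {zero} {zero} _ → refl })
      (refl , v∈C , (λ ()) , (λ ()) , λ { zero 0≢0 → ⊥-elim (0≢0 refl) })

    gravLaws-inside : ∀ {v} m p → Injective _≡_ _≡_ p → GravLaws C v m p → ∀ i → Inside (p i)
    gravLaws-inside m p inj laws zero = subst Inside (sym (proj₁ laws)) (toGravPath inj laws)
    gravLaws-inside (suc m) p inj (_ , end , steps , noEdge , noVertex) (suc i) =
      gravLaws-inside m (p ∘ suc) (λ eq → suc-injective (inj eq))
        (refl , end , steps ∘ suc , noEdge ∘ suc ,
         λ j _ j≢m → noVertex (suc j) (λ ()) (j≢m ∘ suc-injective)) i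

    gravPath-inside : ∀ {v} (Q : GravPath G C v) i → Inside (GravPath.p Q i)
    gravPath-inside Q = gravLaws-inside (GravPath.m Q) (GravPath.p Q) (GravPath.inj Q) (gravLaws Q)

    extendGravPath : ∀ {y r} (Q : GravPath G C r) → Adj G y r → (∀ D → ¬ OnCycleEdge G D y r) →
                     GravPath.m Q ≡ 0 ⊎ ¬ OnSomeCycle G r → (∀ i → y ≢ GravPath.p Q i) → Inside y
    extendGravPath {y} {r} Q a yr∉cycles r-end y∉Q =
      toGravPath {p = y ∷ p} inj
        (refl , GravPath.end Q ,
         (λ { zero → subst (Adj G y) (sym start) a ; (suc i) → GravPath.steps Q i }) ,
         (λ { zero D e → yr∉cycles D (subst (OnCycleEdge G D y) start e)
            ; (suc i) → GravPath.noEdge Q i }) ,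
         noVertex)
      where
      m : ℕ
      m = GravPath.m Q

      p : Fin (suc m) → Fin n
      p = GravPath.p Q

      start : p zero ≡ r
      start = GravPath.start Q

      inj : Injective _≡_ _≡_ (y ∷ p)
      inj {zero}  {zero}  _  = refl
      inj {zero}  {suc j} eq = ⊥-elim (y∉Q j eq)
      inj {suc i} {zero}  eq = ⊥-elim (y∉Q i (sym eq))
      inj {suc i} {suc j} eq = cong suc (GravPath.inj Q eq)

      one≡last : ∀ {k} → k ≡ 0 → suc {suc k} zero ≡ fromℕ (suc k)
      one≡last refl = refl

      noVertex : ∀ i → i ≢ zero → i ≢ fromℕ (suc m) → ∀ D → ¬ OnCycle G D ((y ∷ p) i)
      noVertex zero          i≢0 _   = ⊥-elim (i≢0 refl)
      noVertex (suc zero)    _   i≢m D r∈D =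
        [ i≢m ∘ one≡last ,
          (λ r∉cycles → r∉cycles (D , subst (OnCycle G D) start r∈D)) ]′ r-end
      noVertex (suc (suc i)) _   i≢m = GravPath.noVertex Q (suc i) (λ ()) (i≢m ∘ cong suc)

    exit⇒onSomeCycle : ∀ {y r} → Inside r → Outside y → Adj G y r → OnSomeCycle G r
    exit⇒onSomeCycle {y} {r} r∈ y∉ a with onSomeCycle? r
    ... | yes r∈cycle = r∈cycle
    ... | no r∉cycles with any? (λ i → y ≟ GravPath.p r∈ i)
    ...   | yes (i , refl) = ⊥-elim (y∉ (gravPath-inside r∈ i))
    ...   | no y∉Q         =
      ⊥-elim (y∉ (extendGravPath r∈ a (λ D e → r∉cycles (D , proj₂ (onCycleEdge-ends D e)))
                                  (inj₂ r∉cycles) (curry y∉Q)))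

    exit⇒boundary : ∀ {y r} → Inside r → Outside y → Adj G y r → BoundaryVertex G C r
    exit⇒boundary {y} {r} r∈ y∉ a with exit⇒onSomeCycle r∈ y∉ a | onCycle? C r
    ... | D , r∈D | no r∉C = r∈ , D , r∈D , λ C≈D → r∉C (sameCycle-onCycle {C} {D} C≈D r∈D)
    ... | _       | yes r∈C with onSomeCycleEdge? y r
    ...   | yes (E , yr∈E) =
      r∈ , E , proj₂ (onCycleEdge-ends E yr∈E) ,
      λ C≈E → y∉ (onCycle⇒inside (proj₁ (onCycleEdge-ends C (proj₂ (C≈E y r) yr∈E))))
    ...   | no yr∉cycles   =
      ⊥-elim (y∉ (extendGravPath (onCycle⇒inside r∈C) a (curry yr∉cycles) (inj₁ refl)
                                 λ _ → adjacent⇒≢ a))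

    RegionEdge : Fin n → Fin n → Set
    RegionEdge u v = OnCycleEdge G C u v ⊎ (∀ D → ¬ OnCycleEdge G D u v)

    regionEdge-sym : ∀ {u v} → RegionEdge u v → RegionEdge v u
    regionEdge-sym = Sum.map (onCycleEdge-sym C) (λ uv∉cycles D → uv∉cycles D ∘ onCycleEdge-sym D)

    regionEdge? : ∀ u v → Dec (RegionEdge u v)
    regionEdge? u v = onCycleEdge? C u v ⊎-dec map′ curry uncurry (¬? (onSomeCycleEdge? u v))

    regionEdge-cycle : ∀ {u w y} (E : Cycle G) → RegionEdge u w → OnCycleEdge G E u w →
                       OnCycleEdge G E y u → Inside y
    regionEdge-cycle E (inj₂ uw∉cycles) uw∈E yu∈E = ⊥-elim (uw∉cycles E uw∈E)
    regionEdge-cycle {u} {w} {y} E (inj₁ uw∈C) uw∈E yu∈E =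
      onCycle⇒inside (proj₁ (onCycleEdge-ends C (proj₁ (cactus E C u w uw∈E uw∈C y u) yu∈E)))

    base : Fin n
    base = Cycle.vs C zero

    walkToBase : ∀ {r} → Inside r → ∃[ k ] RWalk Inside RegionEdge r base k
    walkToBase Q =
      let i , end∈C = GravPath.end Q
          k₁ , W₁   = walkAlong (GravPath.m Q) (GravPath.p Q) (gravPath-inside Q) (GravPath.steps Q)
                                (inj₂ ∘ GravPath.noEdge Q) zero
          _ , W₂    = walkAlong (2 + Cycle.k C) (Cycle.vs C) (λ i → onCycle⇒inside (i , refl))
                                (Cycle.steps C)
                                (λ i → inj₁ (inj₁ (inj₁ (i , refl , refl)))) i
      in _ , subst₂ (λ u v → RWalk Inside RegionEdge u v k₁) (GravPath.start Q) end∈C W₁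
             ++ snoc W₂ (Cycle.close C) (inj₁ (inj₁ (inj₂ (refl , refl)))) (onCycle⇒inside (zero , refl))

    regionRoute : ∀ {r₁ r₂} → Inside r₁ → Inside r₂ → ∃[ k ] RWalk Inside RegionEdge r₁ r₂ k
    regionRoute r₁∈ r₂∈ =
      _ , proj₂ (walkToBase r₁∈) ++ reverse regionEdge-sym (proj₂ (walkToBase r₂∈))

    noDetour : ∀ {r₁ r₂ y₁ y₂ j} → Inside r₁ → Inside r₂ → r₁ ≢ r₂ →
               Adj G r₁ y₁ → RWalk Outside ⊤ᵉ y₁ y₂ j → Adj G y₂ r₂ → ⊥
    noDetour r₁∈ r₂∈ r₁≢r₂ a₁ Y a₂
      with shortest inside? regionEdge? (proj₂ (regionRoute r₂∈ r₁∈))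
         | shortest outside? (λ _ _ → yes tt) Y
    ... | _ , here _ , _ | _ = r₁≢r₂ refl
    ... | _ , step r₂∈′ b e R , shortR | _ , Y′ , shortY =
      let E , r₂w∈E , y₂r₂∈E = cycleOfPath tt b tt (bridge (forget R) a₁ tt (forget Y′)) isPath a₂
      in end∈P Y′ (regionEdge-cycle E e r₂w∈E y₂r₂∈E)
      where
      R-path : IsPath (step r₂∈′ b e R)
      R-path = shortest⇒isPath (step r₂∈′ b e R) shortR

      disjoint : ∀ {x} → x ∈ᵂ forget R → ¬ x ∈ᵂ forget Y′
      disjoint x∈R x∈Y = ∈ᵂ⇒P Y′ (∈-forget Y′ x∈Y) (∈ᵂ⇒P R (∈-forget R x∈R))

      isPath : IsPath (step tt b tt (bridge (forget R) a₁ tt (forget Y′)))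
      isPath =
        [ proj₁ R-path ∘ ∈-forget R , (λ r₂∈Y → ∈ᵂ⇒P Y′ (∈-forget Y′ r₂∈Y) r₂∈) ]′
          ∘ ∈-bridge (forget R) a₁ tt (forget Y′) ,
        bridge-isPath (forget R) a₁ tt (forget Y′) (forget-isPath R (proj₂ R-path))
          (forget-isPath Y′ (shortest⇒isPath Y′ shortY)) disjoint

    data Entry (s x : Fin n) : ℕ → Set where
      entry : ∀ {y r k₁ k₂} → RWalk Outside ⊤ᵉ s y k₁ → Adj G y r → Inside r →
              RWalk ⊤ᵛ ⊤ᵉ r x k₂ → Entry s x (k₁ + suc k₂)

    firstEntry : ∀ {s x k} → Outside s → Inside x → RWalk ⊤ᵛ ⊤ᵉ s x k → Entry s x k
    firstEntry s∉ x∈ (here _)                 = ⊥-elim (s∉ x∈)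
    firstEntry s∉ x∈ (step {w = w} _ a _ W) with inside? w
    ... | yes w∈ = entry (here s∉) a w∈ W
    ... | no  w∉ with firstEntry w∉ x∈ W
    ...   | entry O a′ r∈ W′ = entry (step s∉ a tt O) a′ r∈ W′

    k₂<k₁+1+k₂ : ∀ k₁ k₂ → k₂ < suc (k₁ + suc k₂)
    k₂<k₁+1+k₂ k₁ k₂ = s≤s (≤-trans (n≤1+n k₂) (m≤n+m (suc k₂) k₁))

    shortest-inside : ∀ {x y k} (W : RWalk ⊤ᵛ ⊤ᵉ x y k) → Shortest W → Inside x → Inside y →
                      RWalk Inside ⊤ᵉ x y k
    shortest-inside (here _) _ x∈ _ = here x∈
    shortest-inside {x} (step {w = w} _ a _ W) short x∈ y∈ with inside? w
    ... | yes w∈ = step x∈ a tt (shortest-inside W (shortest-tail _ a _ W short) w∈ y∈)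
    ... | no  w∉ with firstEntry w∉ y∈ W
    ...   | entry {r = r} {k₁} {k₂} O a′ r∈ W′ with x ≟ r
    ...     | yes refl = ⊥-elim (≤⇒≯ (short k₂ W′) (k₂<k₁+1+k₂ k₁ k₂))
    ...     | no  x≢r  = ⊥-elim (noDetour x∈ r∈ x≢r a O a′)

    dist-inside : ∀ {x y d} → Inside x → Inside y → Dist G ⊤ᵛ x y d → Dist G Inside x y d
    dist-inside x∈ y∈ (W , minimal) =
      toWalk (shortest-inside (fromWalk W) (λ j W′ → minimal j (toWalk W′)) x∈ y∈) ,
      λ j W′ → minimal j (toWalk (forget (fromWalk W′)))

    record Gate (s b : Fin n) : Set where
      field
        offset : ℕ
        shift  : ∀ {x d} → Inside x → Dist G ⊤ᵛ s x d → ∃[ e ] (Dist G Inside b x e × d ≡ offset + e)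

    gate-inside : ∀ {s} → Inside s → Gate s s
    gate-inside s∈ = record { offset = 0 ; shift = λ x∈ D → _ , dist-inside s∈ x∈ D , refl }

    gate-outside : Connected G → ∀ {s} → Outside s → ∃[ b ] (BoundaryVertex G C b × Gate s b)
    gate-outside connected {s} s∉ with connected s base
    ... | _ , W with firstEntry s∉ (onCycle⇒inside (zero , refl)) (fromWalk W)
    ...   | entry {r = b} O₀ a₀ b∈ _ with distance connected s b
    ...     | d₀ , W₀ , minimal₀ =
      b , exit⇒boundary b∈ (end∈P O₀) a₀ , record { offset = d₀ ; shift = shift }
      where
      shift : ∀ {x d} → Inside x → Dist G ⊤ᵛ s x d → ∃[ e ] (Dist G Inside b x e × d ≡ d₀ + e)
      shift {x} x∈ (W , minimal) with distance connected b x | firstEntry s∉ x∈ (fromWalk W)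
      ... | e , Wₑ , minimalₑ | entry {r = r} {k₁} {k₂} O a r∈ W′ with b ≟ r
      ...   | no  b≢r  =
        ⊥-elim (noDetour b∈ r∈ b≢r (Graph.sym G _ _ a₀) (reverse (λ _ → tt) O₀ ++ O) a)
      ...   | yes refl = e , dist-inside b∈ x∈ (Wₑ , minimalₑ) , ≤-antisym upper lower
        where
        upper : k₁ + suc k₂ ≤ d₀ + e
        upper = minimal (d₀ + e) (toWalk (fromWalk W₀ ++ fromWalk Wₑ))

        lower : d₀ + e ≤ k₁ + suc k₂
        lower = subst (d₀ + e ≤_) (sym (+-suc k₁ k₂))
                      (+-mono-≤ (minimal₀ (suc k₁) (toWalk (snoc (forget O) a tt tt)))
                                (minimalₑ k₂ (toWalk W′)))

    gate-distinguishesV : ∀ {s b x y} → Gate s b → Inside x → Inside y →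
                          DistinguishesV G ⊤ᵛ s x y → DistinguishesV G Inside b x y
    gate-distinguishesV g x∈ y∈ (dx , dy , Dx , Dy , dx≢dy) =
      let ex , Ex , dx≡ = shift x∈ Dx
          ey , Ey , dy≡ = shift y∈ Dy
      in ex , ey , Ex , Ey , λ ex≡ey → dx≢dy (trans dx≡ (trans (cong (offset +_) ex≡ey) (sym dy≡)))
      where open Gate g

    gate-distE : ∀ {s b x x′ d} (g : Gate s b) → Inside x → Inside x′ → DistE G ⊤ᵛ s x x′ d →
                 ∃[ e ] (DistE G Inside b x x′ e × d ≡ Gate.offset g + e)
    gate-distE {d = d} g x∈ x′∈ (d₁ , d₂ , D₁ , D₂ , d≡) =
      let e₁ , E₁ , d₁≡ = shift x∈ D₁
          e₂ , E₂ , d₂≡ = shift x′∈ D₂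
      in e₁ ⊓ e₂ , (e₁ , e₂ , E₁ , E₂ , refl) ,
         (begin
           d                             ≡⟨ d≡ ⟩
           d₁ ⊓ d₂                       ≡⟨ cong₂ _⊓_ d₁≡ d₂≡ ⟩
           (offset + e₁) ⊓ (offset + e₂) ≡⟨ sym (+-distribˡ-⊓ offset e₁ e₂) ⟩
           offset + e₁ ⊓ e₂              ∎)
      where open Gate g
            open ≡-Reasoning

    gate-distinguishesE : ∀ {s b x x′ y y′} → Gate s b → Inside x → Inside x′ → Inside y → Inside y′ →
                          DistinguishesE G ⊤ᵛ s x x′ y y′ → DistinguishesE G Inside b x x′ y y′
    gate-distinguishesE g x∈ x′∈ y∈ y′∈ (dx , dy , Dx , Dy , dx≢dy) =
      let ex , Ex , dx≡ = gate-distE g x∈ x′∈ Dx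
          ey , Ey , dy≡ = gate-distE g y∈ y′∈ Dy
      in ex , ey , Ex , Ey ,
         λ ex≡ey → dx≢dy (trans dx≡ (trans (cong (Gate.offset g +_) ex≡ey) (sym dy≡)))

    regional-gate : Connected G → ∀ {S s} → s ∈ S → ∃[ b ] (RegionalSet G S C b × Gate s b)
    regional-gate connected {s = s} s∈S with inside? s
    ... | yes s∈ = s , inj₁ (s∈S , s∈) , gate-inside s∈
    ... | no  s∉ = let b , boundary , g = gate-outside connected s∉ in b , inj₂ boundary , g

    regionalSet⇒inside : ∀ {S s} → RegionalSet G S C s → Inside s
    regionalSet⇒inside = [ proj₂ , proj₁ ]′

    regional-vertexMetricGenerator : Connected G → ∀ S → VertexMetricGenerator G ⊤ᵛ (_∈ S) →
                                     VertexMetricGenerator G Inside (RegionalSet G S C)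
    regional-vertexMetricGenerator connected S (_ , generates) =
      (λ _ → regionalSet⇒inside) ,
      λ x y x∈ y∈ x≢y →
        let s , s∈S , distinguishes = generates x y tt tt x≢y
            b , b∈ , g = regional-gate connected s∈S
        in b , b∈ , gate-distinguishesV g x∈ y∈ distinguishes

    regional-edgeMetricGenerator : Connected G → ∀ S → EdgeMetricGenerator G ⊤ᵛ (_∈ S) →
                                   EdgeMetricGenerator G Inside (RegionalSet G S C)
    regional-edgeMetricGenerator connected S (_ , generates) =
      (λ _ → regionalSet⇒inside) ,
      λ x x′ y y′ (x∈ , x′∈ , xx′ , x<x′) (y∈ , y′∈ , yy′ , y<y′) ≢ →
        let s , s∈S , distinguishes =
              generates x x′ y y′ (tt , tt , xx′ , x<x′) (tt , tt , yy′ , y<y′) ≢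
            b , b∈ , g = regional-gate connected s∈S
        in b , b∈ , gate-distinguishesE g x∈ x′∈ y∈ y′∈ distinguishes

lemma8 : ∀ (n : ℕ) (G : Graph n) → Connected G → Cactus G →
         ∀ (S : Subset n) (C : Cycle G) →
         (VertexMetricGenerator G (λ _ → ⊤) (λ s → s ∈ S) →
            VertexMetricGenerator G (InRegion G C) (RegionalSet G S C))
         × (EdgeMetricGenerator G (λ _ → ⊤) (λ s → s ∈ S) →
            EdgeMetricGenerator G (InRegion G C) (RegionalSet G S C))
lemma8 n G connected cactus S C =
  regional-vertexMetricGenerator connected S , regional-edgeMetricGenerator connected S
  where open Region G cactus C
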